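{- Let $\Delta$ be a matroid on the ground set $[n]$ such that $[d]$ is a basis of $\Delta$, and order the bases of $\Delta$ lexicographically with respect to the natural order of $[n]$. Let $B$ be a basis of $\Delta$ and let $I=B-[d]$. Then $I\subseteq \mathcal{R}(B)$.
   Context: For a shelling order $B_1,\dots,B_k$ of the bases of a matroid, the restriction set $\mathcal{R}(B_i)$ is the unique subset of $B_i$ such that a subset $A\subseteq B_i$ is not contained in any $B_j$ with $j<i$ if and only if $\mathcal{R}(B_i)\subseteq A$. Here the shelling is the lexicographic order of bases, which is a shelling order for a matroid. -}

module Defs where

open import Data.Nat using (ℕ; _<?_; _≤_)
open import Data.Fin using (Fin; toℕ; _<_)
open import Data.Fin.Subset using (Subset; _∈_; _∉_; _⊆_; _∪_; _─_; _-_; ⁅_⁆)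
open import Data.Vec using (tabulate)
open import Data.Product using (Σ; ∃; _×_)
open import Relation.Nullary using (¬_)
open import Relation.Nullary.Decidable using (⌊_⌋)
open import Function.Bundles using (_⇔_)

record Matroid (n : ℕ) : Set₁ where
  field
    IsBasis  : Subset n → Set
    nonempty : ∃ λ B → IsBasis B
    exchange : ∀ {B₁ B₂} → IsBasis B₁ → IsBasis B₂ →
               ∀ {x} → x ∈ B₁ → x ∉ B₂ →
               ∃ λ y → y ∈ B₂ × y ∉ B₁ × IsBasis ((B₁ - x) ∪ ⁅ y ⁆)

-- [d] = {1,…,d}, i.e. the elements of Fin n with index < d.
initSeg : ∀ {n} → ℕ → Subset n
initSeg d = tabulate (λ i → ⌊ toℕ i <? d ⌋)

-- Lexicographic order on subsets w.r.t. the natural order of [n]: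
-- A precedes B iff the smallest element of the symmetric difference lies in A.
-- (For sets of equal size, e.g. bases, this is the lex order of their
-- increasing sequences.)
LexLess : ∀ {n} → Subset n → Subset n → Set
LexLess A B = ∃ λ i → i ∈ A × i ∉ B × (∀ j → j < i → (j ∈ A ⇔ j ∈ B))

-- R is the restriction set of the basis B in the lexicographic shelling of M:
-- R ⊆ B and for every A ⊆ B, A is contained in no lexicographically earlier
-- basis iff R ⊆ A.
IsRestrictionSet : ∀ {n} → Matroid n → Subset n → Subset n → Set
IsRestrictionSet M B R =
  R ⊆ B ×
  (∀ A → A ⊆ B →
     ((¬ ∃ λ B' → Matroid.IsBasis M B' × LexLess B' B × A ⊆ B') ⇔ R ⊆ A))

-- Let x ∈ B with x ∉ [d]. Exchanging x out of B against the basis [d] yields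
-- y ∈ [d] − B with (B − x) ∪ {y} a basis; since y < d ≤ x, this basis precedes B
-- lexicographically and contains B − x. So B − x lies in an earlier basis, which
-- by the defining property of R means R ⊈ B − x, i.e. x ∈ R.
module Submission where

open import Defs
open import Data.Nat using (ℕ; _≤_)
open import Data.Fin.Subset using (Subset; _⊆_; _─_)

open import Data.Bool.Properties using (T-≡)
open import Data.Empty using (⊥-elim)
open import Data.Fin using (Fin; toℕ; _<_)
open import Data.Fin.Subset using (_∈_; _∉_; _∪_; _-_; ⁅_⁆; inside)
open import Data.Fin.Subset.Properties
  using (_∈?_; p─q⊆p; p⊆p∪q; x∈p∪q⁻; x∈p∪q⁺; x∈⁅x⁆; x∈⁅y⁆⇒x≡y; x∈p∧x≢y⇒x∈p-y)
import Data.Nat as Nat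
open import Data.Nat.Properties using (<-≤-trans; <-irrefl; <-trans; ≮⇒≥)
open import Data.Product using (∃; _×_; _,_)
open import Data.Sum using (inj₁; inj₂)
open import Data.Vec using (_∷_; here; there)
open import Data.Vec.Properties using (lookup∘tabulate; []=⇒lookup; lookup⇒[]=)
open import Function using (_∘_)
open import Function.Bundles using (_⇔_; mk⇔; Equivalence)
open import Relation.Nullary using (yes; no)
open import Relation.Nullary.Decidable using (toWitness; fromWitness)
open import Relation.Binary.PropositionalEquality using (_≢_; refl; trans; sym)

x∈p─q⇒x∉q : ∀ {n} {x : Fin n} {p q : Subset n} → x ∈ p ─ q → x ∉ q
x∈p─q⇒x∉q {x = Fin.zero}  {_ ∷ p} {inside  ∷ q} ()        here
x∈p─q⇒x∉q {x = Fin.suc x} {_ ∷ p} {_       ∷ q} (there m) (there m') =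
  x∈p─q⇒x∉q {p = p} m m'

∈initSeg⇔<d : ∀ {n} {d} {x : Fin n} → x ∈ initSeg d ⇔ toℕ x Nat.< d
∈initSeg⇔<d {d = d} {x} = mk⇔
  (λ x∈ → toWitness (Equivalence.from T-≡
             (trans (sym (lookup∘tabulate _ x)) ([]=⇒lookup x∈))))
  (λ x<d → lookup⇒[]= x _
             (trans (lookup∘tabulate _ x) (Equivalence.to T-≡ (fromWitness x<d))))

∈initSeg∧∉initSeg⇒< : ∀ {n} {d} {x y : Fin n} →
  y ∈ initSeg d → x ∉ initSeg d → y < x
∈initSeg∧∉initSeg⇒< y∈ x∉ =
  <-≤-trans (Equivalence.to ∈initSeg⇔<d y∈)
            (≮⇒≥ (x∉ ∘ Equivalence.from ∈initSeg⇔<d))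

∈-exchange⇔ : ∀ {n} {B : Subset n} {x y z} → z ≢ x → z ≢ y →
  z ∈ (B - x) ∪ ⁅ y ⁆ ⇔ z ∈ B
∈-exchange⇔ {B = B} {x} {y} {z} z≢x z≢y =
  mk⇔ from-exchange (λ z∈B → p⊆p∪q ⁅ y ⁆ (x∈p∧x≢y⇒x∈p-y z∈B z≢x))
  where
  from-exchange : z ∈ (B - x) ∪ ⁅ y ⁆ → z ∈ B
  from-exchange z∈ with x∈p∪q⁻ (B - x) ⁅ y ⁆ z∈
  ... | inj₁ z∈B-x = p─q⊆p B ⁅ x ⁆ z∈B-x
  ... | inj₂ z∈⁅y⁆ = ⊥-elim (z≢y (x∈⁅y⁆⇒x≡y y z∈⁅y⁆))

exchange-lexLess : ∀ {n} {B : Subset n} {x y} → y ∉ B → y < x →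
  LexLess ((B - x) ∪ ⁅ y ⁆) B
exchange-lexLess {B = B} {x} {y} y∉B y<x =
  y , x∈p∪q⁺ (inj₂ (x∈⁅x⁆ y)) , y∉B ,
  λ z z<y → ∈-exchange⇔ (λ { refl → <-irrefl refl (<-trans z<y y<x) })
                        (λ { refl → <-irrefl refl z<y })

earlierCover⇒∈restrictionSet : ∀ {n} (M : Matroid n) {B R : Subset n} {x} →
  IsRestrictionSet M B R →
  (∃ λ B' → Matroid.IsBasis M B' × LexLess B' B × (B - x) ⊆ B') →
  x ∈ R
earlierCover⇒∈restrictionSet M {B} {R} {x} (R⊆B , restricts) cover with x ∈? R
... | yes x∈R = x∈R
... | no  x∉R =
  ⊥-elim (Equivalence.from (restricts (B - x) (p─q⊆p B ⁅ x ⁆)) R⊆B-x cover)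
  where
  R⊆B-x : R ⊆ B - x
  R⊆B-x z∈R = x∈p∧x≢y⇒x∈p-y (R⊆B z∈R) (λ { refl → x∉R z∈R })

mainTheorem2 : ∀ (n d : ℕ) (M : Matroid n) →
    Matroid.IsBasis M (initSeg d) →
    ∀ (B : Subset n) → Matroid.IsBasis M B →
    ∀ (R : Subset n) → IsRestrictionSet M B R →
    (B ─ initSeg d) ⊆ R
mainTheorem2 n d M [d]-basis B B-basis R R-restricts {x} x∈B─[d]
  with x∉[d] ← x∈p─q⇒x∉q {p = B} x∈B─[d]
  with y , y∈[d] , y∉B , B'-basis ←
         Matroid.exchange M B-basis [d]-basis (p─q⊆p B (initSeg d) x∈B─[d]) x∉[d]
  = earlierCover⇒∈restrictionSet M R-restricts
      ((B - x) ∪ ⁅ y ⁆ , B'-basis ,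
       exchange-lexLess y∉B (∈initSeg∧∉initSeg⇒< y∈[d] x∉[d]) ,
       p⊆p∪q ⁅ y ⁆)
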